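{- Let $\mathcal{W}^{\le\ge}$ be the set of Dyck paths whose sequence of valley heights (read left to right) is weakly unimodal. Then $$\sum_{D\in\mathcal{W}^{\le\ge}}z^{|D|}=\frac{1-4z+3z^2}{1-5z+6z^2-z^3},$$ where $|D|$ is the semilength of $D$.
   Context: A Dyck path of semilength $n$ is a lattice path with steps $\mathbf{u}=(1,1)$ and $\mathbf{d}=(1,-1)$ from $(0,0)$ to $(2n,0)$ never going below the $x$-axis. A valley is an occurrence of consecutive steps $\mathbf{du}$; its height is the $y$-coordinate of its lowest vertex. A sequence $a_1,\dots,a_k$ is weakly unimodal if there is $j$ with $1\le j\le k$ and $a_1\le a_2\le\dots\le a_j\ge a_{j+1}\ge\dots\ge a_k$; the empty sequence (paths with no valleys) counts as unimodal. -}

module Defs where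

open import Data.Bool using (Bool; true; false; _∧_; _∨_; if_then_else_)
open import Data.Nat using (ℕ; zero; suc; _∸_; _≤ᵇ_)
open import Data.List using (List; []; _∷_; length; filterᵇ; take; drop; applyUpTo; foldr)
open import Data.Integer using (ℤ; +_; _*_; _+_; -_)

-- Words in the steps u = (1,1) and d = (1,-1)

data Step : Set where
  u d : Step

words : ℕ → List (List Step)
words zero    = [] ∷ []
words (suc m) = Data.List.concatMap (λ w → (u ∷ w) ∷ (d ∷ w) ∷ []) (words m)

dyckFrom : ℕ → List Step → Bool
dyckFrom zero    []       = true
dyckFrom (suc h) []       = false
dyckFrom h       (u ∷ s)  = dyckFrom (suc h) s
dyckFrom zero    (d ∷ s)  = false
dyckFrom (suc h) (d ∷ s)  = dyckFrom h s

isDyck : List Step → Bool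
isDyck = dyckFrom 0

dyckPaths : ℕ → List (List Step)
dyckPaths n = filterᵇ isDyck (words (n Data.Nat.+ n))

-- Heights of the valleys (occurrences of d u), read left to right;
-- the height of a valley is the y-coordinate of its lowest vertex,
-- i.e. the height after the d step.  h = current height.
valleysFrom : ℕ → List Step → List ℕ
valleysFrom h []            = []
valleysFrom h (u ∷ s)       = valleysFrom (suc h) s
valleysFrom h (d ∷ u ∷ s)   = (h ∸ 1) ∷ valleysFrom (h ∸ 1) (u ∷ s)
valleysFrom h (d ∷ [])      = []
valleysFrom h (d ∷ d ∷ s)   = valleysFrom (h ∸ 1) (d ∷ s)

valleyHeights : List Step → List ℕ
valleyHeights = valleysFrom 0

nondecreasing : List ℕ → Bool
nondecreasing []           = true
nondecreasing (x ∷ [])     = true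
nondecreasing (x ∷ y ∷ s)  = (x ≤ᵇ y) ∧ nondecreasing (y ∷ s)

nonincreasing : List ℕ → Bool
nonincreasing []           = true
nonincreasing (x ∷ [])     = true
nonincreasing (x ∷ y ∷ s)  = (y ≤ᵇ x) ∧ nonincreasing (y ∷ s)

anyᵇ : List Bool → Bool
anyᵇ []      = false
anyᵇ (b ∷ s) = b ∨ anyᵇ s

-- a_1..a_k is weakly unimodal iff there is j with 1 ≤ j ≤ k and
-- a_1 ≤ ... ≤ a_j ≥ a_{j+1} ≥ ... ≥ a_k ; the empty sequence counts.
unimodal : List ℕ → Bool
unimodal []        = true
unimodal s@(_ ∷ _) =
  anyᵇ (applyUpTo (λ i → let j = suc i in
                     nondecreasing (take j s) ∧ nonincreasing (drop i s))
                  (length s))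

countW : ℕ → ℕ
countW n = length (filterᵇ (λ w → unimodal (valleyHeights w)) (dyckPaths n))

Series : Set
Series = ℕ → ℤ

_⊙_ : Series → Series → Series
(f ⊙ g) n = foldr _+_ (+ 0) (applyUpTo (λ i → f i * g (n ∸ i)) (suc n))

poly : List ℤ → Series
poly []       n       = + 0
poly (c ∷ cs) zero    = c
poly (c ∷ cs) (suc n) = poly cs n

genW : Series
genW n = + countW n

module Submission where

-- Dyck words are read by a deterministic automaton whose state is the current height, whether
-- the previous step was d (so that an up step now closes a valley), and the phase of the valley
-- heights read so far: still rising, or already falling, with the last valley height.  Counting
-- accepted continuations from a state gives sequences tied together by first-step
-- decompositions, and two further facts close the system.  Lifting a state by one level
-- multiplies its generating function by z (1 - z²) / (1 - 2z²): the lifted path first reaches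
-- the ground by a down step ending a path of the original state, and after that every valley is
-- on the ground, so it continues with a sequence of pyramids.  And the rising phases with bound
-- 0 and bound 1 differ only on paths whose first valley is on the ground.  Eliminating the
-- auxiliary sequences leaves J (k + 6) + 6 J (k + 2) = 5 J (k + 4) + J k for the number J of
-- continuations after a first up step, and paths of semilength n + 1 are counted by J (2n + 1).

open import Defs
open import Data.Bool using (Bool; true; false; _∧_; _∨_; if_then_else_)
open import Data.Bool.Properties using (∧-zeroʳ; ∨-identityʳ; ∨-zeroʳ)
open import Data.List using (List; []; _∷_; length; filterᵇ; concatMap; applyUpTo; take; drop; foldr)
open import Data.Maybe using (Maybe; just; nothing; maybe)
import Data.Maybe as Maybe
open import Data.Nat using (ℕ; zero; suc; _+_; _*_; _≤ᵇ_)
open import Data.Nat.Properties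
  using (+-assoc; +-comm; +-suc; +-identityʳ; +-cancelʳ-≡; *-distribˡ-+; +-commutativeSemigroup)
open import Algebra.Properties.CommutativeSemigroup +-commutativeSemigroup using (interchange; xy∙z≈zy∙x)
open import Data.Nat.Tactic.RingSolver using (solve-∀)
open import Function using (_∘_)
open import Relation.Binary.PropositionalEquality
  using (_≡_; refl; sym; trans; cong; cong₂; module ≡-Reasoning)

≤ᵇ-suc : ∀ m n → (suc m ≤ᵇ suc n) ≡ (m ≤ᵇ n)
≤ᵇ-suc zero    n = refl
≤ᵇ-suc (suc m) n = refl

≰ᵇ⇒≥ᵇ : ∀ m n → (m ≤ᵇ n) ≡ false → (n ≤ᵇ m) ≡ true
≰ᵇ⇒≥ᵇ zero    n       ()
≰ᵇ⇒≥ᵇ (suc m) zero    _ = refl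
≰ᵇ⇒≥ᵇ (suc m) (suc n) h = trans (≤ᵇ-suc n m) (≰ᵇ⇒≥ᵇ m n (trans (sym (≤ᵇ-suc m n)) h))

data Phase : Set where
  rising falling : ℕ → Phase

advance : Phase → ℕ → Maybe Phase
advance (rising a)  v = just (if a ≤ᵇ v then rising v else falling v)
advance (falling b) v = if v ≤ᵇ b then just (falling v) else nothing

scan : Phase → List ℕ → Bool
scan p []       = true
scan p (v ∷ vs) = maybe (λ q → scan q vs) false (advance p v)

nonincreasing-∷ : ∀ x t → nonincreasing (x ∷ t) ≡ scan (falling x) t
nonincreasing-∷ x []      = refl
nonincreasing-∷ x (y ∷ t) with y ≤ᵇ x
... | true  = nonincreasing-∷ y t
... | false = refl

scan-falling⇒scan-rising : ∀ a t → scan (falling a) t ≡ true → scan (rising a) t ≡ true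
scan-falling⇒scan-rising a []      _ = refl
scan-falling⇒scan-rising a (b ∷ t) h with b ≤ᵇ a | a ≤ᵇ b
... | true  | true  = scan-falling⇒scan-rising b t h
... | true  | false = h
... | false | _     with () ← h

anyᵇ-applyUpTo-guarded : ∀ c (f g : ℕ → Bool) n →
  anyᵇ (applyUpTo (λ i → (c ∧ f i) ∧ g i) n) ≡ c ∧ anyᵇ (applyUpTo (λ i → f i ∧ g i) n)
anyᵇ-applyUpTo-guarded true  f g n       = refl
anyᵇ-applyUpTo-guarded false f g zero    = refl
anyᵇ-applyUpTo-guarded false f g (suc n) = anyᵇ-applyUpTo-guarded false (f ∘ suc) (g ∘ suc) n

unimodal-∷-∷ : ∀ x y t →
  unimodal (x ∷ y ∷ t) ≡ nonincreasing (x ∷ y ∷ t) ∨ ((x ≤ᵇ y) ∧ unimodal (y ∷ t))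
unimodal-∷-∷ x y t = cong (nonincreasing (x ∷ y ∷ t) ∨_)
  (anyᵇ-applyUpTo-guarded (x ≤ᵇ y) (λ i → nondecreasing (take (suc i) (y ∷ t)))
                                   (λ i → nonincreasing (drop i (y ∷ t))) (length (y ∷ t)))

∧-∨-absorb : ∀ c a b → (a ≡ true → b ≡ true) → (c ∧ a) ∨ b ≡ b
∧-∨-absorb c a     true  _ = ∨-zeroʳ (c ∧ a)
∧-∨-absorb c false false _ = cong (_∨ false) (∧-zeroʳ c)
∧-∨-absorb c true  false h with () ← h refl

unimodal-∷ : ∀ x t → unimodal (x ∷ t) ≡ scan (rising x) t
unimodal-∷ x []      = refl
unimodal-∷ x (y ∷ t)
  rewrite unimodal-∷-∷ x y t | unimodal-∷ y t | nonincreasing-∷ y t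
  with x ≤ᵇ y in x≤y
... | true  = ∧-∨-absorb (y ≤ᵇ x) _ _ (scan-falling⇒scan-rising y t)
... | false rewrite ≰ᵇ⇒≥ᵇ x y x≤y = ∨-identityʳ (scan (falling y) t)

unimodal≡scan : ∀ s → unimodal s ≡ scan (rising 0) s
unimodal≡scan []      = refl
unimodal≡scan (x ∷ t) = unimodal-∷ x t

-- at h b p : height h; b records whether the last step was d, so that an up step
-- now closes a valley at height h; p is the phase of the valley heights read so far.
data State : Set where
  dead : State
  at   : ℕ → Bool → Phase → State

up down : State → State
up dead           = dead
up (at h false p) = at (suc h) false p
up (at h true  p) = maybe (at (suc h) false) dead (advance p h)
down dead             = dead
down (at zero    _ p) = dead
down (at (suc h) _ p) = at h true p

step : State → Step → State
step σ u = up σ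
step σ d = down σ

accepting : State → Bool
accepting (at zero _ _) = true
accepting _             = false

run : State → List Step → Bool
run σ []      = accepting σ
run σ (s ∷ w) = run (step σ s) w

start : State
start = at 0 false (rising 0)

valleysAfter : ℕ → Bool → List Step → List ℕ
valleysAfter h false w = valleysFrom h w
valleysAfter h true  w = valleysFrom (suc h) (d ∷ w)

run-dead : ∀ w → run dead w ≡ false
run-dead []      = refl
run-dead (u ∷ w) = run-dead w
run-dead (d ∷ w) = run-dead w

run-correct : ∀ h b p w → run (at h b p) w ≡ dyckFrom h w ∧ scan p (valleysAfter h b w)
run-correct zero    false p []      = refl
run-correct zero    true  p []      = refl
run-correct (suc h) _     p []      = refl
run-correct zero    false p (u ∷ w) = run-correct 1 false p w
run-correct (suc h) false p (u ∷ w) = run-correct (2 + h) false p w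
run-correct zero    true  p (u ∷ w) with advance p 0
... | just q  = run-correct 1 false q w
... | nothing = trans (run-dead w) (sym (∧-zeroʳ (dyckFrom 1 w)))
run-correct (suc h) true  p (u ∷ w) with advance p (suc h)
... | just q  = run-correct (2 + h) false q w
... | nothing = trans (run-dead w) (sym (∧-zeroʳ (dyckFrom (2 + h) w)))
run-correct zero    _     p (d ∷ w) = run-dead w
run-correct (suc h) false p (d ∷ w) = run-correct h true p w
run-correct (suc h) true  p (d ∷ w) = run-correct h true p w

run-start : ∀ w → (isDyck w ∧ unimodal (valleyHeights w)) ≡ run start w
run-start w = trans (cong (isDyck w ∧_) (unimodal≡scan (valleyHeights w)))
                    (sym (run-correct 0 false (rising 0) w))

count : State → ℕ → ℕ
count σ zero    = if accepting σ then 1 else 0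
count σ (suc m) = count (up σ) m + count (down σ) m

length-filterᵇ-concatMap-pair : ∀ {A B : Set} (P : B → Bool) (f g : A → B) xs →
  length (filterᵇ P (concatMap (λ x → f x ∷ g x ∷ []) xs))
    ≡ length (filterᵇ (P ∘ f) xs) + length (filterᵇ (P ∘ g) xs)
length-filterᵇ-concatMap-pair P f g []       = refl
length-filterᵇ-concatMap-pair P f g (x ∷ xs) with P (f x)
... | true with P (g x)
...   | true  = cong suc (trans (cong suc (length-filterᵇ-concatMap-pair P f g xs)) (sym (+-suc _ _)))
...   | false = cong suc (length-filterᵇ-concatMap-pair P f g xs)
length-filterᵇ-concatMap-pair P f g (x ∷ xs) | false with P (g x)
...   | true  = trans (cong suc (length-filterᵇ-concatMap-pair P f g xs)) (sym (+-suc _ _))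
...   | false = length-filterᵇ-concatMap-pair P f g xs

length-filterᵇ-filterᵇ : ∀ {A : Set} (P Q R : A → Bool) xs → (∀ x → (P x ∧ Q x) ≡ R x) →
  length (filterᵇ Q (filterᵇ P xs)) ≡ length (filterᵇ R xs)
length-filterᵇ-filterᵇ P Q R []       h = refl
length-filterᵇ-filterᵇ P Q R (x ∷ xs) h rewrite sym (h x) with P x
... | false = length-filterᵇ-filterᵇ P Q R xs h
... | true with Q x
...   | true  = cong suc (length-filterᵇ-filterᵇ P Q R xs h)
...   | false = length-filterᵇ-filterᵇ P Q R xs h

length-filterᵇ-run-words : ∀ σ m → length (filterᵇ (run σ) (words m)) ≡ count σ m
length-filterᵇ-run-words σ zero with accepting σ
... | true  = refl
... | false = refl
length-filterᵇ-run-words σ (suc m) =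
  trans (length-filterᵇ-concatMap-pair (run σ) (u ∷_) (d ∷_) (words m))
        (cong₂ _+_ (length-filterᵇ-run-words (up σ) m) (length-filterᵇ-run-words (down σ) m))

countW≡count : ∀ n → countW n ≡ count start (n + n)
countW≡count n =
  trans (length-filterᵇ-filterᵇ isDyck _ (run start) (words (n + n)) run-start)
        (length-filterᵇ-run-words start (n + n))

z^_ : ℕ → ℕ → ℕ
(z^ zero)  zero    = 1
(z^ zero)  (suc m) = 0
(z^ suc k) zero    = 0
(z^ suc k) (suc m) = (z^ k) m

z^_·_ : ℕ → (ℕ → ℕ) → ℕ → ℕ
(z^ zero  · f) m       = f m
(z^ suc k · f) zero    = 0
(z^ suc k · f) (suc m) = (z^ k · f) m

z^·-cong : ∀ k {f g : ℕ → ℕ} → (∀ m → f m ≡ g m) → ∀ m → (z^ k · f) m ≡ (z^ k · g) m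
z^·-cong zero    f≗g m       = f≗g m
z^·-cong (suc k) f≗g zero    = refl
z^·-cong (suc k) f≗g (suc m) = z^·-cong k f≗g m

count-dead : ∀ m → count dead m ≡ 0
count-dead zero    = refl
count-dead (suc m) = cong₂ _+_ (count-dead m) (count-dead m)

z^·count-dead : ∀ k m → (z^ k · count dead) m ≡ 0
z^·count-dead zero    m       = count-dead m
z^·count-dead (suc k) zero    = refl
z^·count-dead (suc k) (suc m) = z^·count-dead k m

z^·count-aloft : ∀ k h b p m →
  (z^ k · count (at (suc h) b p)) m
    ≡ (z^ suc k · count (up (at (suc h) b p))) m + (z^ suc k · count (at h true p)) m
z^·count-aloft zero    h b p zero    = refl
z^·count-aloft zero    h b p (suc m) = refl
z^·count-aloft (suc k) h b p zero    = refl
z^·count-aloft (suc k) h b p (suc m) = z^·count-aloft k h b p m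

z^·count-ground : ∀ k b p m →
  (z^ k · count (at 0 b p)) m ≡ (z^ suc k · count (up (at 0 b p))) m + (z^ k) m
z^·count-ground zero    b p zero    = refl
z^·count-ground zero    b p (suc m) = cong (count (up (at 0 b p)) m +_) (count-dead m)
z^·count-ground (suc k) b p zero    = refl
z^·count-ground (suc k) b p (suc m) = z^·count-ground k b p m

count-suc-up : ∀ σ → down σ ≡ dead → ∀ m → count σ (suc m) ≡ count (up σ) m
count-suc-up σ σ↓≡dead m =
  trans (cong (λ τ → count (up σ) m + count τ m) σ↓≡dead)
        (trans (cong (count (up σ) m +_) (count-dead m)) (+-identityʳ _))

T J I₀ I₁ U K : ℕ → ℕ
T  = count start
J  = count (at 1 false (rising 0))
I₀ = count (at 2 false (rising 0))
I₁ = count (at 2 false (rising 1))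
U  = count (at 1 false (falling 0))
K  = count (at 0 true (falling 0))

T-suc : ∀ m → T (suc m) ≡ J m
T-suc = count-suc-up start refl

J-suc : ∀ m → J (suc m) ≡ I₀ m + T m
J-suc m = cong (I₀ m +_) (T-after-down m)
  where
  T-after-down : ∀ m → count (at 0 true (rising 0)) m ≡ T m
  T-after-down zero    = refl
  T-after-down (suc m) = refl

K-suc : ∀ m → K (suc m) ≡ U m
K-suc = count-suc-up (at 0 true (falling 0)) refl

falling₀-descent : ∀ h m →
  count (at (2 + h) false (falling 0)) (suc m) ≡ count (at (suc h) false (falling 0)) m
falling₀-descent h zero    = refl
falling₀-descent h (suc m) =
  cong₂ _+_ (falling₀-descent (suc h) m) (cong (_+ count (at h true (falling 0)) m) (count-dead m))

U-rec : ∀ m → U (2 + m) ≡ 2 * U m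
U-rec m = trans (cong₂ _+_ (falling₀-descent 0 m) (K-suc m))
                (cong (U m +_) (sym (+-identityʳ (U m))))

-- K counts sequences of pyramids, K = (1 - z²) / (1 - 2z²).
K-rec : ∀ m → K m + (z^ 2) m ≡ 2 * (z^ 2 · K) m + (z^ 0) m
K-rec 0             = refl
K-rec 1             = refl
K-rec 2             = refl
K-rec (suc (suc (suc m))) =
  cong (_+ 0) (trans (K-suc (2 + m)) (trans (U-rec m) (cong (2 *_) (sym (K-suc m)))))

liftPhase : Phase → Phase
liftPhase (rising a)  = rising (suc a)
liftPhase (falling b) = falling (suc b)

lift : State → State
lift dead       = dead
lift (at h b p) = at (suc h) b (liftPhase p)

advance-lift : ∀ p h → advance (liftPhase p) (suc h) ≡ Maybe.map liftPhase (advance p h)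
advance-lift (rising a)  h rewrite ≤ᵇ-suc a h with a ≤ᵇ h
... | true  = refl
... | false = refl
advance-lift (falling b) h rewrite ≤ᵇ-suc h b with h ≤ᵇ b
... | true  = refl
... | false = refl

up-lift : ∀ σ → up (lift σ) ≡ lift (up σ)
up-lift dead           = refl
up-lift (at h false p) = refl
up-lift (at h true  p) rewrite advance-lift p h with advance p h
... | just q  = refl
... | nothing = refl

K-lift : ∀ p m → count (at 0 true (liftPhase p)) m ≡ K m
K-lift p           zero    = refl
K-lift (rising a)  (suc m) = refl
K-lift (falling b) (suc m) = refl

balanced-+ : ∀ (f f′ : ℕ → ℕ) m {b q b′ q′} →
  f m + b ≡ 2 * (z^ 2 · f) m + q → f′ m + b′ ≡ 2 * (z^ 2 · f′) m + q′ →
  (f m + f′ m) + (b + b′) ≡ 2 * ((z^ 2 · f) m + (z^ 2 · f′) m) + (q + q′)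
balanced-+ f f′ m {b} {q} {b′} {q′} e e′ = begin
  (f m + f′ m) + (b + b′)                  ≡⟨ interchange (f m) (f′ m) b b′ ⟩
  (f m + b) + (f′ m + b′)                  ≡⟨ cong₂ _+_ e e′ ⟩
  (2 * c + q) + (2 * c′ + q′)              ≡⟨ interchange (2 * c) q (2 * c′) q′ ⟩
  (2 * c + 2 * c′) + (q + q′)              ≡⟨ cong (_+ (q + q′)) (sym (*-distribˡ-+ 2 c c′)) ⟩
  2 * (c + c′) + (q + q′)                  ∎
  where
  open ≡-Reasoning
  c c′ : ℕ
  c  = (z^ 2 · f) m
  c′ = (z^ 2 · f′) m

count-lift : ∀ σ m →
  count (lift σ) m + (z^ 3 · count σ) m ≡ 2 * (z^ 2 · count (lift σ)) m + (z^ 1 · count σ) m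
count-lift dead       zero    = refl
count-lift (at _ _ _) zero    = refl
count-lift dead       (suc m)
  rewrite count-dead (suc m) | z^·count-dead 2 m | z^·count-dead 1 m | z^·count-dead 0 m = refl
count-lift σ@(at (suc h) b p) (suc m)
  rewrite z^·count-aloft 2 h b p m | z^·count-aloft 1 (suc h) b (liftPhase p) m
        | z^·count-aloft 0 h b p m | up-lift σ
  = balanced-+ (count (lift (up σ))) (count (lift (down σ))) m
               (count-lift (up σ) m) (count-lift (down σ) m)
count-lift σ@(at zero b p) (suc m)
  rewrite z^·count-ground 2 b p m | z^·count-aloft 1 0 b (liftPhase p) m
        | z^·count-ground 0 b p m | up-lift σ | K-lift p m | z^·-cong 2 (K-lift p) m
  = balanced-+ (count (lift (up σ))) K m (count-lift (up σ) m) (K-rec m)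

-- The bound matters only at a valley on the ground; from height h after a down step the first
-- such valley is reached along d^h u, after which the phase is rising 0 or falling 0.
rising-ground-difference : ∀ h m →
  count (at h true (rising 0)) m + (z^ suc h · U) m ≡ count (at h true (rising 1)) m + (z^ suc h · J) m
rising-ground-difference zero    zero    = refl
rising-ground-difference zero    (suc m) = xy∙z≈zy∙x (J m) (count dead m) (U m)
rising-ground-difference (suc h) zero    = refl
rising-ground-difference (suc h) (suc m) = begin
  (x + count (at h true (rising 0)) m) + (z^ suc h · U) m  ≡⟨ +-assoc x _ _ ⟩
  x + (count (at h true (rising 0)) m + (z^ suc h · U) m)  ≡⟨ cong (x +_) (rising-ground-difference h m) ⟩
  x + (count (at h true (rising 1)) m + (z^ suc h · J) m)  ≡⟨ +-assoc x _ _ ⟨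
  (x + count (at h true (rising 1)) m) + (z^ suc h · J) m  ∎
  where
  open ≡-Reasoning
  x : ℕ
  x = count (at (2 + h) false (rising (suc h))) m

-- Both sides count only paths whose first valley is on the ground, and starting one level
-- lower removes exactly one down step before that valley.
rising-difference-descends : ∀ g m →
  count (at (2 + g) false (rising 0)) m + (z^ 1 · count (at (suc g) false (rising 1))) m
    ≡ count (at (2 + g) false (rising 1)) m + (z^ 1 · count (at (suc g) false (rising 0))) m
rising-difference-descends g zero          = refl
rising-difference-descends g (suc zero)    = refl
rising-difference-descends g (suc (suc m)) = begin
  (B 0 (3 + g) (suc m) + (x + A 0 g m)) + (B 1 (2 + g) m + A 1 g m)
    ≡⟨ regroup (B 0 (3 + g) (suc m)) x (A 0 g m) (B 1 (2 + g) m) (A 1 g m) ⟩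
  (B 0 (3 + g) (suc m) + B 1 (2 + g) m) + (x + (A 0 g m + A 1 g m))
    ≡⟨ cong₂ _+_ (rising-difference-descends (suc g) (suc m)) (cong (x +_) (+-comm (A 0 g m) _)) ⟩
  (B 1 (3 + g) (suc m) + B 0 (2 + g) m) + (x + (A 1 g m + A 0 g m))
    ≡⟨ regroup (B 1 (3 + g) (suc m)) x (A 1 g m) (B 0 (2 + g) m) (A 0 g m) ⟨
  (B 1 (3 + g) (suc m) + (x + A 1 g m)) + (B 0 (2 + g) m + A 0 g m)
    ∎
  where
  open ≡-Reasoning
  B A : ℕ → ℕ → ℕ → ℕ
  B a h = count (at h false (rising a))
  A a h = count (at h true (rising a))
  x : ℕ
  x = count (at (2 + g) false (rising (suc g))) m
  regroup : ∀ p x a r b → (p + (x + a)) + (r + b) ≡ (p + r) + (x + (a + b))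
  regroup = solve-∀

I₀-I₁ : ∀ m → I₀ m + (z^ 2 · I₁) m + (z^ 3 · U) m ≡ I₁ m + (z^ 2 · I₀) m + (z^ 3 · J) m
I₀-I₁ zero    = refl
I₀-I₁ (suc m) = begin
  (b₀ + a₀) + s₁ + zU                   ≡⟨ regroup b₀ a₀ s₁ zU ⟩
  (b₀ + s₁) + (a₀ + zU)                 ≡⟨ cong₂ _+_ (rising-difference-descends 1 m)
                                                     (rising-ground-difference 1 m) ⟩
  (b₁ + s₀) + (a₁ + zJ)                 ≡⟨ regroup b₁ a₁ s₀ zJ ⟨
  (b₁ + a₁) + s₀ + zJ                   ∎
  where
  open ≡-Reasoning
  b₀ b₁ a₀ a₁ s₀ s₁ zU zJ : ℕ
  b₀ = count (at 3 false (rising 0)) m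
  b₁ = count (at 3 false (rising 1)) m
  a₀ = count (at 1 true (rising 0)) m
  a₁ = count (at 1 true (rising 1)) m
  s₀ = (z^ 1 · I₀) m
  s₁ = (z^ 1 · I₁) m
  zU = (z^ 2 · U) m
  zJ = (z^ 2 · J) m
  regroup : ∀ w x y z → (w + x) + y + z ≡ (w + y) + (x + z)
  regroup = solve-∀

cancel-by : ∀ {l r s s′} → s ≡ s′ → l + s ≡ r + s′ → l ≡ r
cancel-by {l} {r} {s} refl e = +-cancelʳ-≡ s l r e

J-step : ∀ k → J (2 + k) ≡ I₀ (1 + k) + J k
J-step k = trans (J-suc (1 + k)) (cong (I₀ (1 + k) +_) (T-suc k))

I₁-lift : ∀ k → I₁ (3 + k) + J k ≡ 2 * I₁ (1 + k) + J (2 + k)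
I₁-lift k = count-lift (at 1 false (rising 0)) (3 + k)

J-I₁-U : ∀ k → J (4 + k) + I₁ (1 + k) + U k ≡ I₁ (3 + k) + 2 * J (2 + k)
J-I₁-U k =
  cancel-by (cong₂ _+_ (cong₂ _+_ (sym (J-step (2 + k))) (sym (I₀-I₁ (3 + k)))) (J-step k))
            (certificate (J k) (J (2 + k)) (J (4 + k)) (I₀ (1 + k)) (I₀ (3 + k))
                         (I₁ (1 + k)) (I₁ (3 + k)) (U k))
  where
  certificate : ∀ j₀ j₂ j₄ p₁ p₃ i₁ i₃ u₀ →
    (j₄ + i₁ + u₀) + ((p₃ + j₂) + (i₃ + p₁ + j₀) + j₂)
      ≡ (i₃ + 2 * j₂) + (j₄ + (p₃ + i₁ + u₀) + (p₁ + j₀))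
  certificate = solve-∀

I₁-closed-form : ∀ k → I₁ (1 + k) + 3 * J (2 + k) ≡ J (4 + k) + J k + U k
I₁-closed-form k =
  cancel-by (cong₂ _+_ (J-I₁-U k) (I₁-lift k))
            (certificate (J k) (J (2 + k)) (J (4 + k)) (I₁ (1 + k)) (I₁ (3 + k)) (U k))
  where
  certificate : ∀ j₀ j₂ j₄ i₁ i₃ u₀ →
    (i₁ + 3 * j₂) + ((j₄ + i₁ + u₀) + (i₃ + j₀))
      ≡ (j₄ + j₀ + u₀) + ((i₃ + 2 * j₂) + (2 * i₁ + j₂))
  certificate = solve-∀

J-recurrence : ∀ k → J (6 + k) + 6 * J (2 + k) ≡ 5 * J (4 + k) + J k
J-recurrence k =
  cancel-by (cong₂ _+_ (cong₂ _+_ (cong₂ _+_ (I₁-closed-form (2 + k)) (sym (I₁-lift k)))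
                                  (cong (2 *_) (sym (I₁-closed-form k))))
                       (U-rec k))
            (certificate (J k) (J (2 + k)) (J (4 + k)) (J (6 + k)) (I₁ (1 + k)) (I₁ (3 + k))
                         (U k) (U (2 + k)))
  where
  certificate : ∀ j₀ j₂ j₄ j₆ i₁ i₃ u₀ u₂ →
    (j₆ + 6 * j₂) + ((i₃ + 3 * j₄) + (2 * i₁ + j₂) + 2 * (j₄ + j₀ + u₀) + u₂)
      ≡ (5 * j₄ + j₀) + ((j₆ + j₂ + u₂) + (i₃ + j₀) + 2 * (i₁ + 3 * j₂) + 2 * u₀)
  certificate = solve-∀

countW-J : ∀ i k → countW (suc (i + k)) ≡ J (2 * i + (k + suc k))
countW-J i k = trans (countW≡count (suc (i + k)))
                     (trans (T-suc ((i + k) + suc (i + k))) (cong J (index i k)))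
  where
  index : ∀ i k → (i + k) + suc (i + k) ≡ 2 * i + (k + suc k)
  index = solve-∀

countW-recurrence : ∀ k →
  countW (4 + k) + 6 * countW (2 + k) ≡ 5 * countW (3 + k) + countW (1 + k)
countW-recurrence k
  rewrite countW-J 3 k | countW-J 2 k | countW-J 1 k | countW-J 0 k = J-recurrence (k + suc k)

open import Data.Integer using (ℤ; +_; -_)
import Data.Integer as ℤ
import Data.Integer.Properties as ℤ
import Data.Integer.Tactic.RingSolver as ℤ-Solver

sum-zeros : ∀ n → foldr ℤ._+_ (+ 0) (applyUpTo (λ _ → + 0) n) ≡ + 0
sum-zeros zero    = refl
sum-zeros (suc n) = trans (ℤ.+-identityˡ _) (sum-zeros n)

⊙-cubic : ∀ a b c e (g : Series) n →
  (poly (a ∷ b ∷ c ∷ e ∷ []) ⊙ g) (3 + n)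
    ≡ a ℤ.* g (3 + n) ℤ.+ (b ℤ.* g (2 + n) ℤ.+ (c ℤ.* g (1 + n) ℤ.+ (e ℤ.* g n ℤ.+ + 0)))
⊙-cubic a b c e g n =
  cong (λ t → a ℤ.* g (3 + n) ℤ.+ (b ℤ.* g (2 + n) ℤ.+ (c ℤ.* g (1 + n) ℤ.+ (e ℤ.* g n ℤ.+ t))))
       (sum-zeros n)

recurrence⇒ℤ : ∀ a b c e → a + 6 * c ≡ 5 * b + e →
  + 1 ℤ.* + a ℤ.+ (- (+ 5) ℤ.* + b ℤ.+ (+ 6 ℤ.* + c ℤ.+ (- (+ 1) ℤ.* + e ℤ.+ + 0))) ≡ + 0
recurrence⇒ℤ a b c e h = begin
  + 1 ℤ.* + a ℤ.+ (- (+ 5) ℤ.* + b ℤ.+ (+ 6 ℤ.* + c ℤ.+ (- (+ 1) ℤ.* + e ℤ.+ + 0)))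
    ≡⟨ rearrange (+ a) (+ b) (+ c) (+ e) ⟩
  (+ 6 ℤ.* + c ℤ.+ + a) ℤ.- (+ 5 ℤ.* + b ℤ.+ + e)
    ≡⟨ cong₂ ℤ._-_ (embed 6 c a) (embed 5 b e) ⟨
  + (6 * c + a) ℤ.- + (5 * b + e)
    ≡⟨ cong (λ x → + x ℤ.- + (5 * b + e)) (trans (+-comm (6 * c) a) h) ⟩
  + (5 * b + e) ℤ.- + (5 * b + e)
    ≡⟨ ℤ.+-inverseʳ (+ (5 * b + e)) ⟩
  + 0 ∎
  where
  open ≡-Reasoning
  rearrange : ∀ (x y z w : ℤ) →
    + 1 ℤ.* x ℤ.+ (- (+ 5) ℤ.* y ℤ.+ (+ 6 ℤ.* z ℤ.+ (- (+ 1) ℤ.* w ℤ.+ + 0)))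
      ≡ (+ 6 ℤ.* z ℤ.+ x) ℤ.- (+ 5 ℤ.* y ℤ.+ w)
  rearrange = ℤ-Solver.solve-∀
  embed : ∀ k y x → + (k * y + x) ≡ + k ℤ.* + y ℤ.+ + x
  embed k y x = trans (ℤ.pos-+ (k * y) x) (cong (ℤ._+ + x) (ℤ.pos-* k y))

mainTheorem13 : (n : ℕ) →
    (poly (+ 1 ∷ - (+ 5) ∷ + 6 ∷ - (+ 1) ∷ []) ⊙ genW) n ≡ poly (+ 1 ∷ - (+ 4) ∷ + 3 ∷ []) n
mainTheorem13 0 = refl
mainTheorem13 1 = refl
mainTheorem13 2 = refl
mainTheorem13 3 = refl
mainTheorem13 (suc (suc (suc (suc k)))) =
  trans (⊙-cubic (+ 1) (- (+ 5)) (+ 6) (- (+ 1)) genW (1 + k))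
        (recurrence⇒ℤ (countW (4 + k)) (countW (3 + k)) (countW (2 + k)) (countW (1 + k))
                      (countW-recurrence k))
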